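{- Let $k$ be a nonnegative integer, let $H$ be a self $k$-resolved graph of order $n_2$, and let $G$ be a nontrivial connected graph of order $n_1$ having $t_1$ true twin equivalence classes and diameter $D(G)<k$. If $\dim(G)=n_1-t_1$, then $\dim(G\boxtimes H)=n_2(n_1-t_1)$.
   Context: All graphs are simple and connected; $d_G$ is the shortest-path distance. A set $S\subseteq V(G)$ is a metric generator for $G$ if for every two distinct vertices $x,y$ there is $s\in S$ with $d_G(s,x)\ne d_G(s,y)$; $\dim(G)$ is the minimum cardinality of a metric generator. The strong product $G\boxtimes H$ has vertex set $V(G)\times V(H)$, with $(a,b)$ and $(c,d)$ adjacent iff ($a=c$ and $bd\in E(H)$) or ($b=d$ and $ac\in E(G)$) or ($ac\in E(G)$ and $bd\in E(H)$). The interval $I[x,y]$ is the set of vertices on some shortest $x$–$y$ path. A connected graph $H$ is self $k$-resolved if for every two distinct vertices $x,y$ there is $w$ with either $d_H(y,w)\ge k$ and $x\in I[y,w]$, or $d_H(x,w)\ge k$ and $y\in I[x,w]$. The true twin equivalence classes of $G$ are the classes of the relation $x\sim y\iff N_G[x]=N_G[y]$, where $N_G[v]$ is the closed neighborhood. Nontrivial means at least two vertices. -}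

module Defs where

open import Data.Nat using (ℕ; zero; suc; _+_; _*_; _∸_; _≤_; _<_)
open import Data.Fin using (Fin; remQuot; _≟_; _<_)
open import Data.Fin.Subset using (Subset; _∈_; ∣_∣)
open import Data.Bool using (Bool; true; false; T; _∧_; _∨_; if_then_else_)
open import Data.Product using (Σ; ∃; ∃-syntax; _×_; _,_; proj₁; proj₂)
open import Data.Sum using (_⊎_)
open import Data.List using (List; []; _∷_; filter; length; allFin)
open import Relation.Nullary using (¬_; Dec; yes; no)
open import Relation.Nullary.Decidable using (⌊_⌋)
open import Relation.Binary.PropositionalEquality using (_≡_; _≢_)

record Graph (n : ℕ) : Set where
  constructor mkGraph
  field
    adj : Fin n → Fin n → Bool

open Graph public

Edge : ∀ {n} → Graph n → Fin n → Fin n → Set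
Edge G x y = T (adj G x y)

IsSimple : ∀ {n} → Graph n → Set
IsSimple G = (∀ x → adj G x x ≡ false) × (∀ x y → adj G x y ≡ adj G y x)

data Walk {n} (G : Graph n) : Fin n → Fin n → ℕ → Set where
  here : ∀ {x} → Walk G x x 0
  step : ∀ {x y z m} → Edge G x y → Walk G y z m → Walk G x z (suc m)

IsConnected : ∀ {n} → Graph n → Set
IsConnected G = ∀ x y → ∃[ m ] Walk G x y m

IsDist : ∀ {n} → Graph n → Fin n → Fin n → ℕ → Set
IsDist G x y m = Walk G x y m × (∀ m' → Walk G x y m' → m ≤ m')

Distinguishes : ∀ {n} → Graph n → Fin n → Fin n → Fin n → Set
Distinguishes G s x y =
  ∃[ a ] ∃[ b ] (IsDist G s x a × IsDist G s y b × a ≢ b)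

IsMetricGenerator : ∀ {n} → Graph n → Subset n → Set
IsMetricGenerator G S =
  ∀ x y → x ≢ y → ∃[ s ] (s ∈ S × Distinguishes G s x y)

IsMetricDim : ∀ {n} → Graph n → ℕ → Set
IsMetricDim G d =
  (∃[ S ] (IsMetricGenerator G S × ∣ S ∣ ≡ d))
  × (∀ S → IsMetricGenerator G S → d ≤ ∣ S ∣)

DiameterLessThan : ∀ {n} → Graph n → ℕ → Set
DiameterLessThan G k = ∀ x y m → IsDist G x y m → m Data.Nat.< k

InInterval : ∀ {n} → Graph n → Fin n → Fin n → Fin n → Set
InInterval G x y w =
  ∃[ a ] ∃[ b ] (Walk G y x a × Walk G x w b × IsDist G y w (a + b))

SelfResolved : ∀ {n} → ℕ → Graph n → Set
SelfResolved k H =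
  IsConnected H ×
  (∀ x y → x ≢ y → ∃[ w ]
     ((∃[ m ] (IsDist H y w m × k ≤ m) × InInterval H x y w)
      ⊎ (∃[ m ] (IsDist H x w m × k ≤ m) × InInterval H y x w)))

allB : ∀ {A : Set} → (A → Bool) → List A → Bool
allB p [] = true
allB p (x ∷ xs) = p x ∧ allB p xs

closedAdj : ∀ {n} → Graph n → Fin n → Fin n → Bool
closedAdj G x z = ⌊ x ≟ z ⌋ ∨ adj G x z

trueTwin : ∀ {n} → Graph n → Fin n → Fin n → Bool
trueTwin {n} G x y = allB (λ z → eqB (closedAdj G x z) (closedAdj G y z)) (allFin n)
  where
  eqB : Bool → Bool → Bool
  eqB true  b = b
  eqB false b = if b then false else true

-- number of true twin equivalence classes = number of vertices that are
-- the least element (in the order of Fin n) of their class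
numTrueTwinClasses : ∀ {n} → Graph n → ℕ
numTrueTwinClasses {n} G = length (filter isRep (allFin n))
  where
  isRepB : Fin n → Bool
  isRepB x = allB (λ y → if ⌊ y Data.Fin.<? x ⌋ then (if trueTwin G x y then false else true) else true) (allFin n)
  isRep : (x : Fin n) → Dec (T (isRepB x))
  isRep x with isRepB x
  ... | true  = yes _
  ... | false = no (λ ())

-- strong product G ⊠ H, vertex (a,b) encoded as combine a b : Fin (n₁ * n₂)
_⊠_ : ∀ {n₁ n₂} → Graph n₁ → Graph n₂ → Graph (n₁ * n₂)
_⊠_ {n₁} {n₂} G H = mkGraph λ u v → f (remQuot n₂ u) (remQuot n₂ v)
  where
  f : Fin n₁ × Fin n₂ → Fin n₁ × Fin n₂ → Bool
  f (a , b) (c , d) =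
    (⌊ a ≟ c ⌋ ∧ adj H b d) ∨ (⌊ b ≟ d ⌋ ∧ adj G a c) ∨ (adj G a c ∧ adj H b d)

-- Distances in G ⊠ H are maxima of the distances in the factors. For the upper
-- bound, S × V(H) resolves G ⊠ H whenever S resolves G: vertices in a common
-- H-fibre are separated by S, and for vertices (a, b), (c, d) with b ≠ d the
-- self k-resolving vertex w gives d_H(w, b) < d_H(w, d) = m ≥ k > D(G), so any
-- (s, w) separates them. For the lower bound, true twins a ≠ a′ of G make
-- (a, b) and (a′, b) mutually dominating in G ⊠ H, hence equidistant from every
-- third vertex; a generator therefore misses at most one vertex of each set
-- (twin class) × {b}, i.e. at most t₁ n₂ vertices. This lower bound holds for
-- every G, so only the generator half of dim(G) = n₁ − t₁ is used.
module Submission where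

open import Defs
open import Data.Bool using (Bool; true; false; T; _∧_; if_then_else_)
open import Data.Bool.Properties using (T-∧; T-∨)
import Data.Bool.Properties as Bool
open import Data.Empty using (⊥-elim)
open import Data.Fin as Fin using (Fin; zero; suc; toℕ; fromℕ; combine; remQuot)
import Data.Fin.Properties as Fin
open import Data.Fin.Subset using (Subset; _∈_; ∣_∣; inside; outside; _-_; ∁)
open import Data.Fin.Subset.Properties
  using (x∈p∧x≢y⇒x∈p-y; x∈p⇒∣p-x∣<∣p∣; ∣⊤∣≡n; ∣⊥∣≡0; x∈∁p⇒x∉p; ∣∁p∣≡n∸∣p∣; ∣p∣≤n)
open import Data.List as List using (filter; length; allFin)
open import Data.Nat using (ℕ; zero; suc; _+_; _*_; _∸_; _≤_; _<_; _⊔_; z≤n; s≤s)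
open import Data.Nat.Properties
open import Data.Product using (∃; ∃-syntax; _×_; _,_; proj₁; proj₂)
import Data.Product as Product
open import Data.Sum using (_⊎_; inj₁; inj₂)
import Data.Sum as Sum
open import Data.Unit using (tt)
open import Data.Vec using ([]; _∷_; lookup; replicate; _++_; tabulate; here; there)
open import Data.Vec.Properties
  using ([]=⇒lookup; lookup⇒[]=; lookup∘tabulate; lookup-++ˡ; lookup-++ʳ; lookup-replicate)
open import Function using (_∘_; id; _⇔_; mk⇔; Equivalence)
open import Relation.Binary.PropositionalEquality
open import Relation.Nullary using (¬_; Dec; yes; no)
open import Relation.Nullary.Decidable using (⌊_⌋; toWitness; fromWitness; _×-dec_; T?)
open import Relation.Unary using (Pred; Decidable)

open Equivalence using (to; from)

injection⇒∣p∣≤∣q∣ : ∀ {m n} {p : Subset m} {q : Subset n} (f : Fin m → Fin n)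
  → (∀ {x} → x ∈ p → f x ∈ q)
  → (∀ {x y} → x ∈ p → y ∈ p → f x ≡ f y → x ≡ y)
  → ∣ p ∣ ≤ ∣ q ∣
injection⇒∣p∣≤∣q∣ {p = []} f maps inj = z≤n
injection⇒∣p∣≤∣q∣ {p = outside ∷ p} f maps inj =
  injection⇒∣p∣≤∣q∣ (f ∘ suc) (maps ∘ there)
    (λ x y → Fin.suc-injective ∘ inj (there x) (there y))
injection⇒∣p∣≤∣q∣ {p = inside ∷ p} {q} f maps inj =
  ≤-trans (s≤s rest) (x∈p⇒∣p-x∣<∣p∣ (maps here))
  where
  rest : ∣ p ∣ ≤ ∣ q - f zero ∣
  rest = injection⇒∣p∣≤∣q∣ (f ∘ suc)
    (λ x → x∈p∧x≢y⇒x∈p-y (maps (there x)) (Fin.0≢1+n ∘ inj here (there x) ∘ sym))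
    (λ x y → Fin.suc-injective ∘ inj (there x) (there y))

cylinder : ∀ {m} n → Subset m → Subset (m * n)
cylinder n [] = []
cylinder n (x ∷ p) = replicate n x ++ cylinder n p

lookup-cylinder : ∀ {m} n (p : Subset m) a b → lookup (cylinder n p) (combine a b) ≡ lookup p a
lookup-cylinder n (x ∷ p) zero b =
  trans (lookup-++ˡ (replicate n x) (cylinder n p) b) (lookup-replicate b x)
lookup-cylinder n (x ∷ p) (suc a) b =
  trans (lookup-++ʳ (replicate n x) (cylinder n p) (combine a b)) (lookup-cylinder n p a b)

∈-cylinder : ∀ {m n} {p : Subset m} {a} b → a ∈ p → combine a b ∈ cylinder n p
∈-cylinder {n = n} {p} {a} b a∈p =
  lookup⇒[]= (combine a b) (cylinder n p) (trans (lookup-cylinder n p a b) ([]=⇒lookup a∈p))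

∣p++q∣ : ∀ {m n} (p : Subset m) (q : Subset n) → ∣ p ++ q ∣ ≡ ∣ p ∣ + ∣ q ∣
∣p++q∣ [] q = refl
∣p++q∣ (inside ∷ p) q = cong suc (∣p++q∣ p q)
∣p++q∣ (outside ∷ p) q = ∣p++q∣ p q

∣cylinder∣ : ∀ {m} n (p : Subset m) → ∣ cylinder n p ∣ ≡ ∣ p ∣ * n
∣cylinder∣ n [] = refl
∣cylinder∣ n (inside ∷ p) =
  trans (∣p++q∣ (replicate n inside) (cylinder n p)) (cong₂ _+_ (∣⊤∣≡n n) (∣cylinder∣ n p))
∣cylinder∣ n (outside ∷ p) =
  trans (∣p++q∣ (replicate n outside) (cylinder n p)) (cong₂ _+_ (∣⊥∣≡0 n) (∣cylinder∣ n p))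

length-filter-tabulate : ∀ {A : Set} {n} (f : A → Bool) (f? : ∀ x → Dec (T (f x)))
  (g : Fin n → A) → length (filter f? (List.tabulate g)) ≡ ∣ tabulate (f ∘ g) ∣
length-filter-tabulate {n = zero} f f? g = refl
length-filter-tabulate {n = suc n} f f? g with f (g zero) | f? (g zero)
... | true | yes _ = cong suc (length-filter-tabulate f f? (g ∘ suc))
... | false | no _ = length-filter-tabulate f f? (g ∘ suc)
... | false | yes ()
... | true | no ¬t = ⊥-elim (¬t tt)

least-Fin : ∀ {ℓ n} {P : Pred (Fin n) ℓ} → Decidable P → ∀ {x} → P x
  → ∃[ r ] P r × (∀ {y} → y Fin.< r → ¬ P y)
least-Fin {n = suc n} P? {x} px with P? zero
... | yes p₀ = zero , p₀ , λ ()
least-Fin {n = suc n} P? {zero} px | no ¬p₀ = ⊥-elim (¬p₀ px)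
least-Fin {n = suc n} P? {suc x} px | no ¬p₀ with least-Fin (P? ∘ suc) px
... | r , pr , below = suc r , pr , λ { {zero} _ → ¬p₀ ; {suc y} (s≤s y<r) → below y<r }

least-ℕ : ∀ {ℓ} {P : Pred ℕ ℓ} → Decidable P → ∀ {m} → P m
  → ∃[ k ] P k × (∀ {j} → P j → k ≤ j)
least-ℕ {P = P} P? {m} pm
  with least-Fin (P? ∘ toℕ) {fromℕ m} (subst P (sym (Fin.toℕ-fromℕ m)) pm)
... | r , pr , below = toℕ r , pr , λ {j} pj → ≮⇒≥ λ j<r →
  let j<1+m = <-trans j<r (Fin.toℕ<n r)
      toℕ-j = Fin.toℕ-fromℕ< j<1+m
  in below (subst (_< toℕ r) (sym toℕ-j) j<r) (subst P (sym toℕ-j) pj)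

IsUndirected : ∀ {n} → Graph n → Set
IsUndirected G = ∀ x y → adj G x y ≡ adj G y x

module _ {n} (G : Graph n) where

  _++ʷ_ : ∀ {x y z a b} → Walk G x y a → Walk G y z b → Walk G x z (a + b)
  here ++ʷ w = w
  step e v ++ʷ w = step e (v ++ʷ w)

  reverseʷ : IsUndirected G → ∀ {x y m} → Walk G x y m → Walk G y x m
  reverseʷ undir here = here
  reverseʷ undir {x} {m = suc m} (step {y = y} e w) =
    subst (Walk G _ x) (+-comm m 1) (reverseʷ undir w ++ʷ step (subst T (undir x y) e) here)

  walk? : ∀ m x y → Dec (Walk G x y m)
  walk? zero x y with x Fin.≟ y
  ... | yes refl = yes here
  ... | no x≢y = no λ { here → x≢y refl }
  walk? (suc m) x y with Fin.any? (λ z → T? (adj G x z) ×-dec walk? m z y)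
  ... | yes (z , e , w) = yes (step e w)
  ... | no ¬w = no λ { (step e w) → ¬w (_ , e , w) }

  walk⇒dist : ∀ {x y m} → Walk G x y m → ∃[ d ] IsDist G x y d × d ≤ m
  walk⇒dist {x} {y} w with least-ℕ (λ m → walk? m x y) w
  ... | d , wd , shortest = d , (wd , λ _ → shortest) , shortest w

  IsDist-refl : ∀ x → IsDist G x x 0
  IsDist-refl x = here , λ _ _ → z≤n

  IsDist-sym : IsUndirected G → ∀ {x y d} → IsDist G x y d → IsDist G y x d
  IsDist-sym undir (w , shortest) = reverseʷ undir w , λ m → shortest m ∘ reverseʷ undir

  IsDist-unique : ∀ {x y d d′} → IsDist G x y d → IsDist G x y d′ → d ≡ d′
  IsDist-unique (w , shortest) (w′ , shortest′) = ≤-antisym (shortest _ w′) (shortest′ _ w)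

  dist-<-diameter : ∀ {k} → IsConnected G → DiameterLessThan G k
    → ∀ x y → ∃[ d ] IsDist G x y d × d < k
  dist-<-diameter conn diam x y with walk⇒dist (proj₂ (conn x y))
  ... | d , dist , _ = d , dist , diam x y d dist

  walk-length-pos : ∀ {x y m} → x ≢ y → Walk G x y m → 0 < m
  walk-length-pos x≢y here = ⊥-elim (x≢y refl)
  walk-length-pos x≢y (step _ _) = s≤s z≤n

  interval-dist-< : IsUndirected G → ∀ {x y w m} → x ≢ y → InInterval G x y w
    → IsDist G y w m → ∃[ d ] IsDist G w x d × d < m
  interval-dist-< undir {x} {y} {w} {m} x≢y (a , b , y⇝x , x⇝w , dist-a+b) dist-m
    with walk⇒dist (reverseʷ undir x⇝w)
  ... | d , dist , d≤b = d , dist , (begin-strict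
    d      ≤⟨ d≤b ⟩
    b      <⟨ +-monoˡ-< b (walk-length-pos (x≢y ∘ sym) y⇝x) ⟩
    a + b  ≡⟨ IsDist-unique dist-a+b dist-m ⟩
    m      ∎)
    where open ≤-Reasoning

allB-tabulate⁺ : ∀ {A : Set} {n} (p : A → Bool) (g : Fin n → A)
  → (∀ i → T (p (g i))) → T (allB p (List.tabulate g))
allB-tabulate⁺ {n = zero} p g all = tt
allB-tabulate⁺ {n = suc n} p g all = from T-∧ (all zero , allB-tabulate⁺ p (g ∘ suc) (all ∘ suc))

allB-tabulate⁻ : ∀ {A : Set} {n} (p : A → Bool) (g : Fin n → A)
  → T (allB p (List.tabulate g)) → ∀ i → T (p (g i))
allB-tabulate⁻ {n = suc n} p g all zero = proj₁ (to T-∧ all)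
allB-tabulate⁻ {n = suc n} p g all (suc i) = allB-tabulate⁻ p (g ∘ suc) (proj₂ (to T-∧ all)) i

module _ {n} (G : Graph n) where

  Twins : Fin n → Fin n → Set
  Twins a b = ∀ z → closedAdj G a z ≡ closedAdj G b z

  twins? : ∀ a b → Dec (Twins a b)
  twins? a b = Fin.all? (λ z → closedAdj G a z Bool.≟ closedAdj G b z)

  trueTwin⇒Twins : ∀ {a b} → T (trueTwin G a b) → Twins a b
  -- The first with brings the pointwise fact into scope, so that the second
  -- one makes the mixed cases absurd.
  trueTwin⇒Twins {a} {b} t z with allB-tabulate⁻ _ id t z
  ... | _ with closedAdj G a z | closedAdj G b z
  ... | true | true = refl
  ... | false | false = refl

  T-closedAdj : ∀ {x z} → T (closedAdj G x z) ⇔ (x ≡ z ⊎ Edge G x z)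
  T-closedAdj {x} {z} = mk⇔
    (Sum.map₁ toWitness ∘ to T-∨)
    (from T-∨ ∘ Sum.map₁ (fromWitness {a? = x Fin.≟ z}))

  twin-edge : IsUndirected G → ∀ {a a′ c} → Twins a a′ → c ≢ a′ → Edge G c a → Edge G c a′
  twin-edge undir {a} {a′} {c} t c≢a′ e
    with to T-closedAdj (subst T (t c) (from T-closedAdj (inj₂ (subst T (undir c a) e))))
  ... | inj₁ a′≡c = ⊥-elim (c≢a′ (sym a′≡c))
  ... | inj₂ e′ = subst T (undir a′ c) e′

  twins-adjacent : IsUndirected G → ∀ {a a′} → Twins a a′ → a ≢ a′ → Edge G a a′
  twins-adjacent undir {a} {a′} t a≢a′
    with to T-closedAdj (subst T (t a) (from T-closedAdj (inj₁ refl)))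
  ... | inj₁ a′≡a = ⊥-elim (a≢a′ (sym a′≡a))
  ... | inj₂ e = subst T (undir a′ a) e

  representative : Fin n → Fin n
  representative a = proj₁ (least-Fin (λ x → twins? x a) {a} (λ _ → refl))

  representative-twin : ∀ a → Twins (representative a) a
  representative-twin a = proj₁ (proj₂ (least-Fin (λ x → twins? x a) {a} (λ _ → refl)))

  same-representative⇒Twins : ∀ {a a′} → representative a ≡ representative a′ → Twins a a′
  same-representative⇒Twins {a} {a′} same z = begin
    closedAdj G a z                     ≡⟨ sym (representative-twin a z) ⟩
    closedAdj G (representative a) z    ≡⟨ cong (λ r → closedAdj G r z) same ⟩
    closedAdj G (representative a′) z   ≡⟨ representative-twin a′ z ⟩
    closedAdj G a′ z                    ∎
    where open ≡-Reasoning

  representative-least : ∀ a {y} → y Fin.< representative a → ¬ Twins y a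
  representative-least a = proj₂ (proj₂ (least-Fin (λ x → twins? x a) {a} (λ _ → refl)))

  -- A copy of the predicate counted by numTrueTwinClasses, which is local to
  -- its where block: x is the least vertex of its true twin class.
  isTwinClassRep : Fin n → Bool
  isTwinClassRep x =
    allB (λ y → if ⌊ y Fin.<? x ⌋ then (if trueTwin G x y then false else true) else true) (allFin n)

  twinClassReps : Subset n
  twinClassReps = tabulate isTwinClassRep

  numTrueTwinClasses≡∣twinClassReps∣ : numTrueTwinClasses G ≡ ∣ twinClassReps ∣
  numTrueTwinClasses≡∣twinClassReps∣ = length-filter-tabulate isTwinClassRep _ id

  representative∈twinClassReps : ∀ a → representative a ∈ twinClassReps
  representative∈twinClassReps a = lookup⇒[]= r twinClassReps
    (trans (lookup∘tabulate isTwinClassRep r)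
      (Bool.T-≡ .to (allB-tabulate⁺ _ id noEarlierTwin)))
    where
    r = representative a
    noEarlierTwin : ∀ y
      → T (if ⌊ y Fin.<? r ⌋ then (if trueTwin G r y then false else true) else true)
    noEarlierTwin y with y Fin.<? r
    ... | no _ = tt
    ... | yes y<r with trueTwin G r y in twin
    ...   | false = tt
    ...   | true = representative-least a y<r
      λ z → trans (sym (trueTwin⇒Twins (subst T (sym twin) tt) z)) (representative-twin a z)

module _ {n} (X : Graph n) where

  Dominates : Fin n → Fin n → Set
  Dominates v u = ∀ y → y ≢ v → Edge X y u → Edge X y v

  walk-to-dominator : ∀ {u v} → Dominates v u → ∀ {s m} → s ≢ u → Walk X s u m
    → ∃[ m′ ] m′ ≤ m × Walk X s v m′
  walk-to-dominator dom s≢u here = ⊥-elim (s≢u refl)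
  walk-to-dominator {u} {v} dom {s} s≢u (step {y = y} e w) with y Fin.≟ u | s Fin.≟ v
  ... | _ | yes refl = 0 , z≤n , here
  ... | yes refl | no s≢v = 1 , s≤s z≤n , step (dom s s≢v e) here
  ... | no y≢u | no _ with walk-to-dominator dom y≢u w
  ...   | m′ , m′≤m , w′ = suc m′ , s≤s m′≤m , step e w′

  mutual-dominators-equidistant : ∀ {u v} → Dominates v u → Dominates u v
    → ∀ {s d d′} → s ≢ u → s ≢ v → IsDist X s u d → IsDist X s v d′ → d ≡ d′
  mutual-dominators-equidistant v≽u u≽v s≢u s≢v (w , shortest) (w′ , shortest′)
    with walk-to-dominator v≽u s≢u w | walk-to-dominator u≽v s≢v w′
  ... | m , m≤d , wv | m′ , m′≤d′ , wu =
    ≤-antisym (≤-trans (shortest _ wu) m′≤d′) (≤-trans (shortest′ _ wv) m≤d)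

  generator-meets-mutual-dominators : ∀ {u v S} → Dominates v u → Dominates u v → u ≢ v
    → IsMetricGenerator X S → u ∈ S ⊎ v ∈ S
  generator-meets-mutual-dominators {u} {v} v≽u u≽v u≢v gen
    with gen u v u≢v
  ... | s , s∈S , d , d′ , dist , dist′ , d≢d′ with s Fin.≟ u | s Fin.≟ v
  ...   | yes refl | _ = inj₁ s∈S
  ...   | no _ | yes refl = inj₂ s∈S
  ...   | no s≢u | no s≢v =
    ⊥-elim (d≢d′ (mutual-dominators-equidistant v≽u u≽v s≢u s≢v dist dist′))

Distinguishes-sym : ∀ {n} {X : Graph n} {s x y} → Distinguishes X s x y → Distinguishes X s y x
Distinguishes-sym (d , d′ , dist , dist′ , d≢d′) = d′ , d , dist′ , dist , d≢d′ ∘ sym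

generator-nonempty : ∀ {n} (X : Graph n) {S} → 2 ≤ n → IsMetricGenerator X S → ∃[ s ] s ∈ S
generator-nonempty X (s≤s (s≤s _)) gen with gen zero (suc zero) (λ ())
... | s , s∈S , _ = s , s∈S

module _ {n₁ n₂} (G : Graph n₁) (H : Graph n₂) where

  π₁ : Fin (n₁ * n₂) → Fin n₁
  π₁ u = proj₁ (remQuot {n₁} n₂ u)

  π₂ : Fin (n₁ * n₂) → Fin n₂
  π₂ u = proj₂ (remQuot {n₁} n₂ u)

  π₁-combine : ∀ a b → π₁ (combine a b) ≡ a
  π₁-combine a b = cong proj₁ (Fin.remQuot-combine {n₁} {n₂} a b)

  π₂-combine : ∀ a b → π₂ (combine a b) ≡ b
  π₂-combine a b = cong proj₂ (Fin.remQuot-combine {n₁} {n₂} a b)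

  combine-π : ∀ u → combine (π₁ u) (π₂ u) ≡ u
  combine-π u = Fin.combine-remQuot {n₁} n₂ u

  data Vertex : Fin (n₁ * n₂) → Set where
    ⟨_,_⟩ : (a : Fin n₁) (b : Fin n₂) → Vertex (combine a b)

  vertex : ∀ u → Vertex u
  vertex u = subst Vertex (combine-π u) ⟨ π₁ u , π₂ u ⟩

  ProductEdge : Fin n₁ → Fin n₂ → Fin n₁ → Fin n₂ → Set
  ProductEdge a b c d = (a ≡ c × Edge H b d) ⊎ (b ≡ d × Edge G a c) ⊎ (Edge G a c × Edge H b d)

  ⊠-edge⇔ : ∀ {u v} → Edge (G ⊠ H) u v ⇔ ProductEdge (π₁ u) (π₂ u) (π₁ v) (π₂ v)
  ⊠-edge⇔ {u} {v} = mk⇔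
    (Sum.map (witness (π₁ u Fin.≟ π₁ v)) (Sum.map (witness (π₂ u Fin.≟ π₂ v)) (to T-∧))
      ∘ Sum.map₂ (to T-∨) ∘ to T-∨)
    (from T-∨ ∘ Sum.map₂ (from T-∨)
      ∘ Sum.map (unwitness (π₁ u Fin.≟ π₁ v)) (Sum.map (unwitness (π₂ u Fin.≟ π₂ v)) (from T-∧)))
    where
    witness : ∀ {A : Set} (a? : Dec A) {x} → T (⌊ a? ⌋ ∧ x) → A × T x
    witness _ = Product.map₁ toWitness ∘ to T-∧
    unwitness : ∀ {A : Set} (a? : Dec A) {x} → A × T x → T (⌊ a? ⌋ ∧ x)
    unwitness _ = from T-∧ ∘ Product.map₁ fromWitness

  ⊠-edge⇔ᶜ : ∀ {a b c d} → Edge (G ⊠ H) (combine a b) (combine c d) ⇔ ProductEdge a b c d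
  ⊠-edge⇔ᶜ {a} {b} {c} {d} = subst (Edge (G ⊠ H) (combine a b) (combine c d) ⇔_)
    (cong₂ (λ (a , b) (c , d) → ProductEdge a b c d)
      (Fin.remQuot-combine {n₁} {n₂} a b) (Fin.remQuot-combine {n₁} {n₂} c d))
    ⊠-edge⇔

  ⊠-edge : ∀ {a b c d} → ProductEdge a b c d → Edge (G ⊠ H) (combine a b) (combine c d)
  ⊠-edge = from ⊠-edge⇔ᶜ

  projectʷ₁ : ∀ {u v m} → Walk (G ⊠ H) u v m → ∃[ p ] p ≤ m × Walk G (π₁ u) (π₁ v) p
  projectʷ₁ here = 0 , z≤n , here
  projectʷ₁ (step e w) with projectʷ₁ w | to ⊠-edge⇔ e
  ... | p , p≤m , w₁ | inj₁ (same , _) =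
    p , m≤n⇒m≤1+n p≤m , subst (λ x → Walk G x _ p) (sym same) w₁
  ... | p , p≤m , w₁ | inj₂ (inj₁ (_ , e₁)) = suc p , s≤s p≤m , step e₁ w₁
  ... | p , p≤m , w₁ | inj₂ (inj₂ (e₁ , _)) = suc p , s≤s p≤m , step e₁ w₁

  projectʷ₂ : ∀ {u v m} → Walk (G ⊠ H) u v m → ∃[ p ] p ≤ m × Walk H (π₂ u) (π₂ v) p
  projectʷ₂ here = 0 , z≤n , here
  projectʷ₂ (step e w) with projectʷ₂ w | to ⊠-edge⇔ e
  ... | p , p≤m , w₂ | inj₂ (inj₁ (same , _)) =
    p , m≤n⇒m≤1+n p≤m , subst (λ x → Walk H x _ p) (sym same) w₂
  ... | p , p≤m , w₂ | inj₁ (_ , e₂) = suc p , s≤s p≤m , step e₂ w₂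
  ... | p , p≤m , w₂ | inj₂ (inj₂ (_ , e₂)) = suc p , s≤s p≤m , step e₂ w₂

  zipʷ : ∀ {a b c d p p′} → Walk G a c p → Walk H b d p′
    → Walk (G ⊠ H) (combine a b) (combine c d) (p ⊔ p′)
  zipʷ here here = here
  zipʷ here (step e₂ w₂) = step (⊠-edge (inj₁ (refl , e₂))) (zipʷ here w₂)
  zipʷ {p = suc p} (step e₁ w₁) here =
    step (⊠-edge (inj₂ (inj₁ (refl , e₁))))
      (subst (Walk (G ⊠ H) _ _) (⊔-identityʳ p) (zipʷ w₁ here))
  zipʷ (step e₁ w₁) (step e₂ w₂) = step (⊠-edge (inj₂ (inj₂ (e₁ , e₂)))) (zipʷ w₁ w₂)

  ⊠-dist : ∀ {a b c d p p′} → IsDist G a c p → IsDist H b d p′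
    → IsDist (G ⊠ H) (combine a b) (combine c d) (p ⊔ p′)
  ⊠-dist {a} {b} {c} {d} {p} {p′} (w₁ , shortest₁) (w₂ , shortest₂) =
    zipʷ w₁ w₂ , λ m w → ⊔-lub (bound₁ w) (bound₂ w)
    where
    bound₁ : ∀ {m} → Walk (G ⊠ H) (combine a b) (combine c d) m → p ≤ m
    bound₁ w with projectʷ₁ w
    ... | q , q≤m , w₁′ =
      ≤-trans (shortest₁ q (subst₂ (λ x y → Walk G x y q) (π₁-combine a b) (π₁-combine c d) w₁′))
        q≤m
    bound₂ : ∀ {m} → Walk (G ⊠ H) (combine a b) (combine c d) m → p′ ≤ m
    bound₂ w with projectʷ₂ w
    ... | q , q≤m , w₂′ =
      ≤-trans (shortest₂ q (subst₂ (λ x y → Walk H x y q) (π₂-combine a b) (π₂-combine c d) w₂′))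
        q≤m

  ⊠-twin-dominates : IsUndirected G → ∀ {a a′} b → Twins G a a′ → a ≢ a′
    → Dominates (G ⊠ H) (combine a′ b) (combine a b)
  ⊠-twin-dominates undir {a} {a′} b t a≢a′ y y≢ e with vertex y
  ... | ⟨ c , d ⟩ with to ⊠-edge⇔ᶜ e
  ... | inj₁ (refl , e₂) = ⊠-edge (inj₂ (inj₂ (twins-adjacent G undir t a≢a′ , e₂)))
  ... | inj₂ (inj₁ (refl , e₁)) =
    ⊠-edge (inj₂ (inj₁ (refl , twin-edge G undir t (y≢ ∘ cong (λ x → combine x d)) e₁)))
  ... | inj₂ (inj₂ (e₁ , e₂)) with c Fin.≟ a′
  ...   | yes c≡a′ = ⊠-edge (inj₁ (c≡a′ , e₂))
  ...   | no c≢a′ = ⊠-edge (inj₂ (inj₂ (twin-edge G undir t c≢a′ e₁ , e₂)))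

  generator-meets-⊠-twins : IsUndirected G → ∀ {a a′ S} b → Twins G a a′ → a ≢ a′
    → IsMetricGenerator (G ⊠ H) S → combine a b ∈ S ⊎ combine a′ b ∈ S
  generator-meets-⊠-twins undir {a} {a′} b t a≢a′ =
    generator-meets-mutual-dominators (G ⊠ H)
      (⊠-twin-dominates undir b t a≢a′)
      (⊠-twin-dominates undir b (sym ∘ t) (a≢a′ ∘ sym))
      (a≢a′ ∘ Fin.combine-injectiveˡ a b a′ b)

  ∣∁S∣≤numTrueTwinClasses*n₂ : IsUndirected G → ∀ {S} → IsMetricGenerator (G ⊠ H) S
    → ∣ ∁ S ∣ ≤ numTrueTwinClasses G * n₂
  ∣∁S∣≤numTrueTwinClasses*n₂ undir {S} gen = begin
    ∣ ∁ S ∣                             ≤⟨ injection⇒∣p∣≤∣q∣ f maps injective ⟩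
    ∣ cylinder n₂ (twinClassReps G) ∣   ≡⟨ ∣cylinder∣ n₂ (twinClassReps G) ⟩
    ∣ twinClassReps G ∣ * n₂            ≡⟨ cong (_* n₂) (sym (numTrueTwinClasses≡∣twinClassReps∣ G)) ⟩
    numTrueTwinClasses G * n₂           ∎
    where
    open ≤-Reasoning
    f : Fin (n₁ * n₂) → Fin (n₁ * n₂)
    f u = combine (representative G (π₁ u)) (π₂ u)
    maps : ∀ {u} → u ∈ ∁ S → f u ∈ cylinder n₂ (twinClassReps G)
    maps {u} _ = ∈-cylinder (π₂ u) (representative∈twinClassReps G (π₁ u))
    injective : ∀ {x y} → x ∈ ∁ S → y ∈ ∁ S → f x ≡ f y → x ≡ y
    injective {x} {y} x∉S y∉S fx≡fy
      with Fin.combine-injective _ _ _ _ fx≡fy | π₁ x Fin.≟ π₁ y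
    ... | _ , same₂ | yes same₁ =
      trans (sym (combine-π x)) (trans (cong₂ combine same₁ same₂) (combine-π y))
    ... | same-rep , same₂ | no differ
      with generator-meets-⊠-twins undir (π₂ x) (same-representative⇒Twins G same-rep) differ gen
    ...   | inj₁ x∈S = ⊥-elim (x∈∁p⇒x∉p x∉S (subst (_∈ S) (combine-π x) x∈S))
    ...   | inj₂ y∈S =
      ⊥-elim (x∈∁p⇒x∉p y∉S (subst (_∈ S) (trans (cong (combine (π₁ y)) same₂) (combine-π y)) y∈S))

  ⊠-dim-lowerBound : IsUndirected G → ∀ S → IsMetricGenerator (G ⊠ H) S
    → n₂ * (n₁ ∸ numTrueTwinClasses G) ≤ ∣ S ∣
  ⊠-dim-lowerBound undir S gen = begin
    n₂ * (n₁ ∸ t₁)                 ≡⟨ *-comm n₂ (n₁ ∸ t₁) ⟩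
    (n₁ ∸ t₁) * n₂                 ≡⟨ *-distribʳ-∸ n₂ n₁ t₁ ⟩
    n₁ * n₂ ∸ t₁ * n₂              ≤⟨ ∸-monoʳ-≤ (n₁ * n₂) ∣∁S∣≤t₁*n₂ ⟩
    n₁ * n₂ ∸ (n₁ * n₂ ∸ ∣ S ∣)    ≡⟨ m∸[m∸n]≡n (∣p∣≤n S) ⟩
    ∣ S ∣                          ∎
    where
    open ≤-Reasoning
    t₁ = numTrueTwinClasses G
    ∣∁S∣≤t₁*n₂ : n₁ * n₂ ∸ ∣ S ∣ ≤ t₁ * n₂
    ∣∁S∣≤t₁*n₂ = subst (_≤ t₁ * n₂) (∣∁p∣≡n∸∣p∣ S) (∣∁S∣≤numTrueTwinClasses*n₂ undir gen)

  ⊠-distinguishes-in-fibre : ∀ {s a c} b → Distinguishes G s a c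
    → Distinguishes (G ⊠ H) (combine s b) (combine a b) (combine c b)
  ⊠-distinguishes-in-fibre b (d , d′ , dist , dist′ , d≢d′) =
    d ⊔ 0 , d′ ⊔ 0 , ⊠-dist dist (IsDist-refl H b) , ⊠-dist dist′ (IsDist-refl H b) ,
    d≢d′ ∘ subst₂ _≡_ (⊔-identityʳ d) (⊔-identityʳ d′)

  ⊠-distinguishes-across-fibres : IsUndirected H → ∀ {k} → IsConnected G → DiameterLessThan G k
    → ∀ {b d w m} s a c → b ≢ d → InInterval H b d w → IsDist H d w m → k ≤ m
    → Distinguishes (G ⊠ H) (combine s w) (combine a b) (combine c d)
  ⊠-distinguishes-across-fibres undir conn diam {m = m} s a c b≢d interval dist-m k≤m
    with dist-<-diameter G conn diam s a | dist-<-diameter G conn diam s c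
       | interval-dist-< H undir b≢d interval dist-m
  ... | g , dist-g , g<k | g′ , dist-g′ , g′<k | ρ , dist-ρ , ρ<m =
    g ⊔ ρ , g′ ⊔ m , ⊠-dist dist-g dist-ρ , ⊠-dist dist-g′ (IsDist-sym H undir dist-m) ,
    λ same → <⇒≢ near (trans same far)
    where
    near : g ⊔ ρ < m
    near = ⊔-pres-<m (<-≤-trans g<k k≤m) ρ<m
    far : g′ ⊔ m ≡ m
    far = m≤n⇒m⊔n≡n (<⇒≤ (<-≤-trans g′<k k≤m))

  ⊠-cylinder-resolves : IsUndirected H → ∀ {k} → SelfResolved k H
    → IsConnected G → DiameterLessThan G k
    → ∀ {S s₀} → IsMetricGenerator G S → s₀ ∈ S → IsMetricGenerator (G ⊠ H) (cylinder n₂ S)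
  ⊠-cylinder-resolves undir (_ , resolve) conn diam {s₀ = s₀} gen s₀∈S u v u≢v
    with vertex u | vertex v
  ... | ⟨ a , b ⟩ | ⟨ c , d ⟩ with b Fin.≟ d
  ...   | yes refl with gen a c (u≢v ∘ cong (λ x → combine x b))
  ...     | s , s∈S , dist = combine s b , ∈-cylinder b s∈S , ⊠-distinguishes-in-fibre b dist
  ⊠-cylinder-resolves undir (_ , resolve) conn diam {s₀ = s₀} gen s₀∈S u v u≢v
    | ⟨ a , b ⟩ | ⟨ c , d ⟩ | no b≢d with resolve b d b≢d
  ... | w , inj₁ (m , (dist-m , k≤m) , interval) =
    combine s₀ w , ∈-cylinder w s₀∈S ,
    ⊠-distinguishes-across-fibres undir conn diam s₀ a c b≢d interval dist-m k≤m
  ... | w , inj₂ (m , (dist-m , k≤m) , interval) =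
    combine s₀ w , ∈-cylinder w s₀∈S ,
    Distinguishes-sym
      (⊠-distinguishes-across-fibres undir conn diam s₀ c a (b≢d ∘ sym) interval dist-m k≤m)

theorem4 : (k n₁ n₂ : ℕ) (G : Graph n₁) (H : Graph n₂)
    → IsSimple H → SelfResolved k H
    → IsSimple G → IsConnected G → 2 ≤ n₁
    → DiameterLessThan G k
    → IsMetricDim G (n₁ ∸ numTrueTwinClasses G)
    → IsMetricDim (G ⊠ H) (n₂ * (n₁ ∸ numTrueTwinClasses G))
theorem4 k n₁ n₂ G H (_ , undirH) resolvedH (_ , undirG) connG 2≤n₁ diamG ((S , genS , ∣S∣≡) , _) =
  (cylinder n₂ S , resolves , size) , ⊠-dim-lowerBound G H undirG
  where
  resolves : IsMetricGenerator (G ⊠ H) (cylinder n₂ S)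
  resolves = ⊠-cylinder-resolves G H undirH resolvedH connG diamG genS
    (proj₂ (generator-nonempty G 2≤n₁ genS))
  size : ∣ cylinder n₂ S ∣ ≡ n₂ * (n₁ ∸ numTrueTwinClasses G)
  size = trans (∣cylinder∣ n₂ S) (trans (cong (_* n₂) ∣S∣≡) (*-comm _ n₂))
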